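{- Let $i\geq 1$ and $i+2\leq j\leq 2i$ be integers and $m\geq 1$. Let $G_m$ be obtained from the path $v_0v_1\ldots v_{2m}$ by adding $j-1$ flags at each of $v_2,v_4,\dots,v_{2m-2}$ and $j$ flags at each of $v_0$ and $v_{2m}$. Then $G_m$ is $(i,j)$-critical.
   Context: Multigraphs are finite without loops. A flag at a vertex $w$ is a new vertex $u$ joined to $w$ by exactly two parallel edges and incident with no other edges. A 2-fold cover of a multigraph $G$ is a pair $(L,\mathcal H)$ where $\mathcal H$ is a graph and $L$ assigns to each $v\in V(G)$ a 2-element set $L(v)=\{p(v),r(v)\}$ ($p(v)$ poor, $r(v)$ rich) such that the sets $L(v)$ partition $V(\mathcal H)$, $p(v)r(v)\in E(\mathcal H)$, edges of $\mathcal H$ between $L(u)$ and $L(v)$ ($u\ne v$) exist only if $uv\in E(G)$, and if $u,v$ are joined by $k\ge1$ edges then $\mathcal H[L(u),L(v)]$ is a union of at most $k$ perfect matchings between $L(u)$ and $L(v)$. An $\mathcal H$-map is a function $\phi$ with $\phi(v)\in L(v)$; $\mathcal H_\phi$ is the subgraph induced by $\phi(V(G))$. An $(i,j)$-coloring is an $\mathcal H$-map $\phi$ in which poor vertices of $\mathcal H_\phi$ have degree at most $i$ and rich ones degree at most $j$ in $\mathcal H_\phi$. $G$ is $(i,j)$-critical if some 2-fold cover of $G$ has no $(i,j)$-coloring while every 2-fold cover of each proper subgraph of $G$ has one. -}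

module Defs where

open import Data.Nat using (ℕ; zero; suc; _+_; _∸_; _≤_; _<_; _≡ᵇ_; _<ᵇ_)
open import Data.Nat.Properties using (+-comm)
open import Data.Bool using (Bool; true; false; if_then_else_; _∧_; not; _xor_)
open import Data.Nat.ListAction using (sum)
open import Data.Fin using (Fin; toℕ; _≟_)
open import Data.List using (List; []; _∷_; _++_; replicate; length; map; allFin; concatMap; upTo)
open import Data.Product using (Σ; ∃; ∃-syntax; _×_; _,_)
open import Data.Sum using (_⊎_)
open import Function.Definitions using (Injective)
open import Relation.Nullary using (¬_; does)
open import Relation.Binary.PropositionalEquality using (_≡_; _≢_; refl)

record Multigraph : Set where
  field
    n      : ℕ
    mult   : Fin n → Fin n → ℕ
    symm   : ∀ u v → mult u v ≡ mult v u
    noLoop : ∀ v → mult v v ≡ 0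
open Multigraph public

b2n : Bool → ℕ
b2n true  = 1
b2n false = 0

-- The cover graph ℋ has vertex set Fin n × Bool, where
-- L(v) = {(v,false), (v,true)}, p(v) = (v,false) (poor), r(v) = (v,true)
-- (rich).  Inside L(v) the edge p(v)r(v) is always present.  Between L(u)
-- and L(v) (u ≠ v) there are exactly two perfect matchings:
--   the "straight" one {p(u)p(v), r(u)r(v)} and the "cross" one
--   {p(u)r(v), r(u)p(v)};
-- so ℋ[L(u),L(v)] being a union of at most k = mult u v perfect matchings
-- means: it is the union of a set of these two matchings of size ≤ k.
-- straight u v / cross u v record which of them are used.

record Cover (G : Multigraph) : Set where
  field
    straight : Fin (n G) → Fin (n G) → Bool
    cross    : Fin (n G) → Fin (n G) → Bool
    symS     : ∀ u v → straight u v ≡ straight v u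
    symC     : ∀ u v → cross u v ≡ cross v u
    bound    : ∀ u v → u ≢ v → b2n (straight u v) + b2n (cross u v) ≤ mult G u v
open Cover public

adjℋ : {G : Multigraph} → Cover G → Fin (n G) × Bool → Fin (n G) × Bool → Bool
adjℋ C (u , a) (v , b) =
  if does (u ≟ v) then a xor b
  else (if a xor b then cross C u v else straight C u v)

-- An ℋ-map: φ v = false means φ(v) = p(v), φ v = true means φ(v) = r(v).
HMap : Multigraph → Set
HMap G = Fin (n G) → Bool

-- Degree of φ(v) in ℋ_φ (the subgraph of ℋ induced by φ(V(G))).
degφ : {G : Multigraph} → Cover G → HMap G → Fin (n G) → ℕ
degφ {G} C φ v =
  sum (map (λ u → b2n (adjℋ C (v , φ v) (u , φ u))) (allFin (n G)))

IsColoring : (i j : ℕ) {G : Multigraph} → Cover G → HMap G → Set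
IsColoring i j C φ = ∀ v → degφ C φ v ≤ (if φ v then j else i)

Colorable : (i j : ℕ) {G : Multigraph} → Cover G → Set
Colorable i j {G} C = Σ (HMap G) λ φ → IsColoring i j C φ

-- Proper subgraphs (up to relabelling of vertices): H embeds into G by an
-- injective vertex map f with mult H u v ≤ mult G (f u) (f v), and H has
-- fewer vertices or some edge multiplicity strictly smaller.

record ProperSubgraph (H G : Multigraph) : Set where
  field
    emb    : Fin (n H) → Fin (n G)
    inj    : Injective _≡_ _≡_ emb
    sub    : ∀ u v → mult H u v ≤ mult G (emb u) (emb v)
    proper : n H < n G ⊎ (∃[ u ] ∃[ v ] mult H u v < mult G (emb u) (emb v))

Critical : (i j : ℕ) → Multigraph → Set
Critical i j G =
  (Σ (Cover G) λ C → ¬ Colorable i j C) ×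
  (∀ H → ProperSubgraph H G → ∀ (C : Cover H) → Colorable i j C)

-- The multigraph G_m (for parameters j, m).
-- Vertices 0 .. 2m are the path v_0 … v_{2m}; vertices 2m+1+f are flags,
-- flag f being attached to path vertex (attachments j m) at position f.

attachments : ℕ → ℕ → List ℕ
attachments j m =
  replicate j 0 ++ replicate j (2 * m) ++
  concatMap (λ t → replicate (j ∸ 1) (2 * suc t)) (upTo (m ∸ 1))
  where open import Data.Nat using (_*_)

attAt : List ℕ → ℕ → ℕ
attAt []       _       = 0
attAt (a ∷ as) zero    = a
attAt (a ∷ as) (suc k) = attAt as k

pathSize : ℕ → ℕ
pathSize m = suc (2 * m)
  where open import Data.Nat using (_*_)

halfMult : ℕ → ℕ → ℕ → ℕ → ℕ
halfMult j m x y =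
  if (y ≡ᵇ suc x) ∧ (y <ᵇ pathSize m) then 1
  else if (x <ᵇ pathSize m) ∧ (not (y <ᵇ pathSize m)
            ∧ (attAt (attachments j m) (y ∸ pathSize m) ≡ᵇ x)) then 2
  else 0

private
  ≡ᵇ-suc : ∀ x → (x ≡ᵇ suc x) ≡ false
  ≡ᵇ-suc zero    = refl
  ≡ᵇ-suc (suc x) = ≡ᵇ-suc x

  halfMult-diag : ∀ j m x → halfMult j m x x ≡ 0
  halfMult-diag j m x rewrite ≡ᵇ-suc x with x <ᵇ pathSize m
  ... | true  = refl
  ... | false = refl

Gm : (j m : ℕ) → Multigraph
Gm j m = record
  { n      = pathSize m + length (attachments j m)
  ; mult   = λ u v → halfMult j m (toℕ u) (toℕ v) + halfMult j m (toℕ v) (toℕ u)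
  ; symm   = λ u v → +-comm (halfMult j m (toℕ u) (toℕ v)) (halfMult j m (toℕ v) (toℕ u))
  ; noLoop = λ v → noLoopPf (toℕ v)
  }
  where
    noLoopPf : ∀ x → halfMult j m x x + halfMult j m x x ≡ 0
    noLoopPf x rewrite halfMult-diag j m x = refl

-- Uncolourable cover: give each flag both matchings and let the path edge
-- v_a v_(a+1) use the straight matching for even a and the crossed one for odd a.
-- In a colouring, v_0 carries j > i flags, so it is rich and already has degree j;
-- hence the straight edge to v_1 is unused, i.e. v_1 is poor.  The crossed edge
-- v_1 v_2 then joins a poor and a rich vertex, and v_2 (with j - 1 > i flags) is
-- again saturated, forcing v_3 poor, and so on up to v_2m, which gets degree j + 1.
--
-- Criticality: a cover of a proper subgraph extends to a cover of G_m that uses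
-- fewer matchings than parallel edges on some edge (a defect), so it suffices to
-- colour such deficient covers.  Make the even path vertices rich, let every flag
-- avoid its attachment vertex, and let every odd path vertex avoid its neighbour on
-- the side away from the defect.  Then an even vertex sees at most one adjacent path
-- neighbour, except the one at the defect, where the deficient flag pays for the
-- second; so even vertices have degree at most j, odd ones at most 2, flags at most 1.

module Submission where

open import Defs
open import Data.Nat using (ℕ; _+_; _≤_; _*_)

open import Data.Nat using (zero; suc; pred; _∸_; _<_; _≡ᵇ_; _<ᵇ_; z≤n; s≤s; s≤s⁻¹; z<s; s<s; s<s⁻¹; >-nonZero; _⊓_)
open import Data.Nat.Properties hiding (_≟_)
open import Data.Bool using (Bool; true; false; if_then_else_; _∧_; _∨_; not; _xor_; T)
import Data.Bool.Properties as Bool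
open import Data.Fin using (Fin; toℕ; _≟_; fromℕ<) renaming (zero to fzero; suc to fsuc)
import Data.Fin.Properties as Fin
open import Data.List using (List; []; _∷_; _++_; replicate; length; map; allFin; tabulate; concatMap; applyUpTo)
import Data.List.Properties as List
open import Data.Nat.ListAction using (sum)
open import Data.List.Relation.Unary.All using (All; []; _∷_)
import Data.List.Relation.Unary.All.Properties as All
open import Data.Product using (∃; _×_; _,_; proj₁; proj₂)
open import Data.Sum using (_⊎_; inj₁; inj₂)
open import Data.Empty using (⊥; ⊥-elim)
open import Function.Base using (_∘_)
open import Function.Bundles using (Equivalence)
open import Function.Definitions using (Injective)
open import Relation.Nullary using (¬_; does; yes; no; Dec)
open import Relation.Nullary.Decidable using (dec-true; dec-false)
open import Relation.Binary.PropositionalEquality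
  using (_≡_; _≢_; ≢-sym; refl; sym; trans; cong; cong₂; subst; subst₂; module ≡-Reasoning)
open import Algebra.Properties.CommutativeMonoid.Sum +-0-commutativeMonoid
  using (∑-distrib-+; ∑-comm; sum-cong-≗; sum-replicate-zero) renaming (sum to ∑)

≡ᵇ-sound : ∀ a b → (a ≡ᵇ b) ≡ true → a ≡ b
≡ᵇ-sound a b e = ≡ᵇ⇒≡ a b (subst T (sym e) _)

≡ᵇ-refl : ∀ a → (a ≡ᵇ a) ≡ true
≡ᵇ-refl a = Equivalence.to Bool.T-≡ (≡⇒≡ᵇ a a refl)

≡ᵇ-false : ∀ a b → a ≢ b → (a ≡ᵇ b) ≡ false
≡ᵇ-false a b a≢b = Bool.¬-not (a≢b ∘ ≡ᵇ-sound a b)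

<ᵇ-sound : ∀ a b → (a <ᵇ b) ≡ true → a < b
<ᵇ-sound a b e = <ᵇ⇒< a b (subst T (sym e) _)

<ᵇ-true : ∀ {a b} → a < b → (a <ᵇ b) ≡ true
<ᵇ-true a<b = Equivalence.to Bool.T-≡ (<⇒<ᵇ a<b)

<ᵇ-false : ∀ {a b} → b ≤ a → (a <ᵇ b) ≡ false
<ᵇ-false {a} {b} b≤a = Bool.¬-not (λ e → <⇒≱ (<ᵇ-sound a b e) b≤a)

<ᵇ-false⇒≥ : ∀ a b → (a <ᵇ b) ≡ false → b ≤ a
<ᵇ-false⇒≥ a b e = ≮⇒≥ (λ a<b → Bool.not-¬ (<ᵇ-true a<b) e)

∧-true : ∀ {a b} → a ∧ b ≡ true → a ≡ true × b ≡ true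
∧-true {true} b≡t = refl , b≡t

true≢false : ∀ {b} → b ≡ true → b ≡ false → ⊥
true≢false refl ()

b2n≡0 : ∀ {b} → b2n b ≡ 0 → b ≡ false
b2n≡0 {false} _ = refl

b2n≥1 : ∀ {b} → 1 ≤ b2n b → b ≡ true
b2n≥1 {true} _ = refl

b2n≤1 : ∀ b → b2n b ≤ 1
b2n≤1 true  = ≤-refl
b2n≤1 false = z≤n

b2n-≤ : ∀ {b n} → (b ≡ true → 1 ≤ n) → b2n b ≤ n
b2n-≤ {true}  1≤n = 1≤n refl
b2n-≤ {false} _   = z≤n

b2n+b2n-≤ : ∀ {a b n} → (a ≡ true → b ≡ true → 1 ≤ n) → b2n a + b2n b ≤ 1 + n
b2n+b2n-≤ {true}  {true}  1≤n = s≤s (1≤n refl refl)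
b2n+b2n-≤ {true}  {false} _   = s≤s z≤n
b2n+b2n-≤ {false} {b}     _   = ≤-trans (b2n≤1 b) (s≤s z≤n)

none-used : ∀ {a b} → b2n a + b2n b < 1 → a ≡ false × b ≡ false
none-used {false} {false} _       = refl , refl
none-used {true}          (s≤s ())
none-used {false} {true}  (s≤s ())

not-both : ∀ {a b} → b2n a + b2n b < 2 → a ∧ b ≡ false
not-both {false}         _                = refl
not-both {true}  {false} _                = refl
not-both {true}  {true}  (s≤s (s≤s ()))

δ : ∀ {n} → Fin n → Fin n → ℕ → ℕ
δ a x c = if does (a ≟ x) then c else 0

sum-map-allFin : ∀ n (f : Fin n → ℕ) → sum (map f (allFin n)) ≡ ∑ f
sum-map-allFin n f = trans (cong sum (List.map-tabulate (λ x → x) f)) (sum-tabulate n f)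
  where
    sum-tabulate : ∀ n (f : Fin n → ℕ) → sum (tabulate f) ≡ ∑ f
    sum-tabulate zero    f = refl
    sum-tabulate (suc n) f = cong (f fzero +_) (sum-tabulate n (f ∘ fsuc))

∑-mono-≤ : ∀ {n} {f g : Fin n → ℕ} → (∀ x → f x ≤ g x) → ∑ f ≤ ∑ g
∑-mono-≤ {zero}  f≤g = z≤n
∑-mono-≤ {suc n} f≤g = +-mono-≤ (f≤g fzero) (∑-mono-≤ (f≤g ∘ fsuc))

∑-δ : ∀ {n} (a : Fin n) (F : Fin n → ℕ) → ∑ (λ x → δ a x (F x)) ≡ F a
∑-δ {suc n} fzero    F = trans (cong (F fzero +_) (sum-replicate-zero n)) (+-identityʳ (F fzero))
∑-δ {suc n} (fsuc a) F = ∑-δ a (F ∘ fsuc)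

δ-≢ : ∀ {n} {a x : Fin n} c → a ≢ x → δ a x c ≡ 0
δ-≢ {a = a} {x} c a≢x rewrite dec-false (a ≟ x) a≢x = refl

δ-≤ : ∀ {n} (a x : Fin n) c → δ a x c ≤ c
δ-≤ a x c with does (a ≟ x)
... | true  = ≤-refl
... | false = z≤n

δ-two : ∀ {n} {a b : Fin n} x c → a ≢ b → δ a x c + δ b x c ≤ c
δ-two {a = a} {b} x c a≢b with a ≟ x
... | yes refl = ≤-reflexive (trans (cong (c +_) (δ-≢ c (a≢b ∘ sym))) (+-identityʳ c))
... | no _     = δ-≤ b x c

δ-self : ∀ {n} (a : Fin n) c → δ a a c ≡ c
δ-self a c rewrite dec-true (a ≟ a) refl = refl

∑-atMostOne : ∀ {n} (P : Fin n → Bool) c → (∀ w w′ → P w ≡ true → P w′ ≡ true → w ≡ w′) →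
              ∑ (λ w → if P w then c else 0) ≤ c
∑-atMostOne {zero}  P c unique = z≤n
∑-atMostOne {suc n} P c unique with P fzero in P0
... | false = ∑-atMostOne (P ∘ fsuc) c (λ w w′ p p′ → Fin.suc-injective (unique (fsuc w) (fsuc w′) p p′))
... | true  = ≤-reflexive (trans (cong (c +_) (trans (sum-cong-≗ rest) (sum-replicate-zero n))) (+-identityʳ c))
  where
    rest : ∀ w → (if P (fsuc w) then c else 0) ≡ 0
    rest w with P (fsuc w) in Pw
    ... | false = refl
    ... | true with () ← unique fzero (fsuc w) P0 Pw

∑-reindex-≤ : ∀ {m n} (e : Fin m → Fin n) → Injective _≡_ _≡_ e → (F : Fin n → ℕ) → ∑ (F ∘ e) ≤ ∑ F
∑-reindex-≤ e e-inj F = begin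
  ∑ (F ∘ e)                              ≡⟨ sum-cong-≗ (λ w → sym (∑-δ (e w) F)) ⟩
  ∑ (λ w → ∑ (λ x → δ (e w) x (F x)))    ≡⟨ ∑-comm (λ w x → δ (e w) x (F x)) ⟩
  ∑ (λ x → ∑ (λ w → δ (e w) x (F x)))
    ≤⟨ ∑-mono-≤ (λ x → ∑-atMostOne (λ w → does (e w ≟ x)) (F x) (preimage-unique x)) ⟩
  ∑ F                                    ∎
  where
    open ≤-Reasoning
    preimage-unique : ∀ x w w′ → does (e w ≟ x) ≡ true → does (e w′ ≟ x) ≡ true → w ≡ w′
    preimage-unique x w w′ p p′ with e w ≟ x | e w′ ≟ x
    ... | yes ew≡x | yes ew′≡x = e-inj (trans ew≡x (sym ew′≡x))

∑< : ℕ → (ℕ → ℕ) → ℕ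
∑< zero    g = 0
∑< (suc n) g = g 0 + ∑< n (g ∘ suc)

∑-toℕ : ∀ n (g : ℕ → ℕ) → ∑ {n} (g ∘ toℕ) ≡ ∑< n g
∑-toℕ zero    g = refl
∑-toℕ (suc n) g = cong (g 0 +_) (∑-toℕ n (g ∘ suc))

∑<-cong : ∀ n {f g : ℕ → ℕ} → (∀ k → k < n → f k ≡ g k) → ∑< n f ≡ ∑< n g
∑<-cong zero    f≡g = refl
∑<-cong (suc n) f≡g = cong₂ _+_ (f≡g 0 z<s) (∑<-cong n (λ k k<n → f≡g (suc k) (s<s k<n)))

∑<-vanish : ∀ n {g : ℕ → ℕ} → (∀ k → k < n → g k ≡ 0) → ∑< n g ≡ 0
∑<-vanish zero    g≡0 = refl
∑<-vanish (suc n) g≡0 = cong₂ _+_ (g≡0 0 z<s) (∑<-vanish n (λ k k<n → g≡0 (suc k) (s<s k<n)))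

∑<-point : ∀ n c {g : ℕ → ℕ} → c < n → (∀ k → k < n → k ≢ c → g k ≡ 0) → ∑< n g ≡ g c
∑<-point (suc n) zero    {g} _ g≡0 =
  trans (cong (g 0 +_) (∑<-vanish n (λ k k<n → g≡0 (suc k) (s<s k<n) λ ()))) (+-identityʳ (g 0))
∑<-point (suc n) (suc c) {g} c<n g≡0 =
  cong₂ _+_ (g≡0 0 z<s λ ()) (∑<-point n c (s<s⁻¹ c<n) (λ k k<n k≢c → g≡0 (suc k) (s<s k<n) (k≢c ∘ suc-injective)))

∑<-split : ∀ a b (g : ℕ → ℕ) → ∑< (a + b) g ≡ ∑< a g + ∑< b (λ k → g (a + k))
∑<-split zero    b g = refl
∑<-split (suc a) b g = trans (cong (g 0 +_) (∑<-split a b (g ∘ suc))) (sym (+-assoc (g 0) _ _))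

data Parity : ℕ → Set where
  even : ∀ u → Parity (2 * u)
  odd  : ∀ u → Parity (suc (2 * u))

parity : ∀ n → Parity n
parity zero = even 0
parity (suc n) with parity n
... | even u = odd u
... | odd u  = subst Parity (*-suc 2 u) (even (suc u))

even? : ℕ → Bool
even? zero    = true
even? (suc n) = not (even? n)

even?-even : ∀ u → even? (2 * u) ≡ true
even?-even zero    = refl
even?-even (suc u) = trans (cong even? (*-suc 2 u)) (trans (Bool.not-involutive _) (even?-even u))

even?-odd : ∀ u → even? (suc (2 * u)) ≡ false
even?-odd u = cong not (even?-even u)

m+n≤m⇒n≡0 : ∀ m {n} → m + n ≤ m → n ≡ 0
m+n≤m⇒n≡0 m {n} m+n≤m = n≤0⇒n≡0 (+-cancelˡ-≤ m n 0 (≤-trans m+n≤m (≤-reflexive (sym (+-identityʳ m)))))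

*-b2n-≡ᵇ-refl : ∀ c a → c * b2n (a ≡ᵇ a) ≡ c
*-b2n-≡ᵇ-refl c a = trans (cong (λ b → c * b2n b) (≡ᵇ-refl a)) (*-identityʳ c)

*-b2n-≡ᵇ-≢ : ∀ c {a b} → a ≢ b → c * b2n (a ≡ᵇ b) ≡ 0
*-b2n-≡ᵇ-≢ c {a} {b} a≢b = trans (cong (λ b → c * b2n b) (≡ᵇ-false a b a≢b)) (*-zeroʳ c)

All-attAt : ∀ {Q : ℕ → Set} → Q 0 → ∀ {l} → All Q l → ∀ k → Q (attAt l k)
All-attAt Q0 []         k       = Q0
All-attAt Q0 (Qa ∷ Qas) zero    = Qa
All-attAt Q0 (Qa ∷ Qas) (suc k) = All-attAt Q0 Qas k

occurrences : ℕ → List ℕ → ℕ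
occurrences p []      = 0
occurrences p (a ∷ l) = b2n (a ≡ᵇ p) + occurrences p l

∑<-attAt : ∀ p l → ∑< (length l) (λ k → b2n (attAt l k ≡ᵇ p)) ≡ occurrences p l
∑<-attAt p []      = refl
∑<-attAt p (a ∷ l) = cong (b2n (a ≡ᵇ p) +_) (∑<-attAt p l)

occurrences-++ : ∀ p l₁ l₂ → occurrences p (l₁ ++ l₂) ≡ occurrences p l₁ + occurrences p l₂
occurrences-++ p []       l₂ = refl
occurrences-++ p (a ∷ l₁) l₂ =
  trans (cong (b2n (a ≡ᵇ p) +_) (occurrences-++ p l₁ l₂)) (sym (+-assoc (b2n (a ≡ᵇ p)) _ _))

occurrences-replicate : ∀ p n a → occurrences p (replicate n a) ≡ n * b2n (a ≡ᵇ p)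
occurrences-replicate p zero    a = refl
occurrences-replicate p (suc n) a = cong (b2n (a ≡ᵇ p) +_) (occurrences-replicate p n a)

occurrences-concatMap : ∀ p (F : ℕ → List ℕ) n (g : ℕ → ℕ) →
  occurrences p (concatMap F (applyUpTo g n)) ≡ ∑< n (λ t → occurrences p (F (g t)))
occurrences-concatMap p F zero    g = refl
occurrences-concatMap p F (suc n) g =
  trans (occurrences-++ p (F (g 0)) _) (cong (occurrences p (F (g 0)) +_) (occurrences-concatMap p F n (g ∘ suc)))

matchings : {G : Multigraph} → Cover G → Fin (n G) → Fin (n G) → ℕ
matchings C x y = b2n (straight C x y) + b2n (cross C x y)

Deficient : {G : Multigraph} → Cover G → Fin (n G) → Fin (n G) → Set
Deficient {G} C x y = matchings C x y < mult G x y

Deficient-sym : ∀ {G} (C : Cover G) {x y} → Deficient C x y → Deficient C y x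
Deficient-sym {G} C {x} {y} =
  subst₂ _<_ (cong₂ (λ s c → b2n s + b2n c) (symS C x y) (symC C x y)) (symm G x y)

module _ {G : Multigraph} (C : Cover G) where

  adjℋ-≡ : ∀ x a b → adjℋ C (x , a) (x , b) ≡ a xor b
  adjℋ-≡ x a b rewrite dec-true (x ≟ x) refl = refl

  adjℋ-≢ : ∀ x y a b → x ≢ y → adjℋ C (x , a) (y , b) ≡ (if a xor b then cross C x y else straight C x y)
  adjℋ-≢ x y a b x≢y rewrite dec-false (x ≟ y) x≢y = refl

  adjℋ-sym : ∀ x y a b → adjℋ C (x , a) (y , b) ≡ adjℋ C (y , b) (x , a)
  adjℋ-sym x y a b with x ≟ y
  ... | yes refl rewrite dec-true (x ≟ x) refl = Bool.xor-comm a b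
  ... | no x≢y rewrite dec-false (y ≟ x) (x≢y ∘ sym) | Bool.xor-comm a b | symC C x y | symS C x y = refl

  adjℋ-unused : ∀ x y a b → x ≢ y → straight C x y ≡ false → cross C x y ≡ false →
                adjℋ C (x , a) (y , b) ≡ false
  adjℋ-unused x y a b x≢y s≡f c≡f rewrite adjℋ-≢ x y a b x≢y | s≡f | c≡f with a xor b
  ... | true  = refl
  ... | false = refl

  adjℋ-avoid : ∀ x y → x ≢ y → adjℋ C (x , true) (y , not (straight C x y)) ≡ straight C x y ∧ cross C x y
  adjℋ-avoid x y x≢y rewrite adjℋ-≢ x y true (not (straight C x y)) x≢y with straight C x y
  ... | true  = refl
  ... | false = refl

  single-edge : ∀ x y → x ≢ y → mult G x y ≡ 1 → straight C x y ∧ cross C x y ≡ false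
  single-edge x y x≢y m≡1 with straight C x y | cross C x y | subst (_ ≤_) m≡1 (bound C x y x≢y)
  ... | false | _     | _ = refl
  ... | true  | false | _ = refl
  ... | true  | true  | s≤s ()

  adjℋ⇒edge : ∀ (φ : HMap G) x y → adjℋ C (x , φ x) (y , φ y) ≡ true → 1 ≤ mult G x y
  adjℋ⇒edge φ x y adj with x ≟ y
  ... | yes refl with () ← trans (sym adj) (Bool.xor-same (φ x))
  ... | no x≢y with mult G x y | bound C x y x≢y
  ...   | suc _ | _ = s≤s z≤n
  ...   | zero  | sc≤0 with straight C x y | cross C x y | sc≤0 | φ x xor φ y
  ...     | false | false | _ | true  with () ← adj
  ...     | false | false | _ | false with () ← adj

  degφ-≤ : ∀ (φ : HMap G) v (g : Fin (n G) → ℕ) →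
           (∀ x → adjℋ C (v , φ v) (x , φ x) ≡ true → 1 ≤ g x) → degφ C φ v ≤ ∑ g
  degφ-≤ φ v g adj⇒g = begin
    degφ C φ v                                    ≡⟨ sum-map-allFin (n G) _ ⟩
    ∑ (λ x → b2n (adjℋ C (v , φ v) (x , φ x)))   ≤⟨ ∑-mono-≤ pointwise ⟩
    ∑ g                                           ∎
    where
      open ≤-Reasoning
      pointwise : ∀ x → b2n (adjℋ C (v , φ v) (x , φ x)) ≤ g x
      pointwise x with adjℋ C (v , φ v) (x , φ x) in adj
      ... | true  = adj⇒g x adj
      ... | false = z≤n

-- Covers of proper subgraphs

module Extension {H G : Multigraph} (S : ProperSubgraph H G) (C : Cover H) where
  open ProperSubgraph S

  Preimage : Fin (n G) → Set
  Preimage x = ∃ λ u → emb u ≡ x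

  preimage? : ∀ x → Dec (Preimage x)
  preimage? x = Fin.any? (λ u → emb u ≟ x)

  transfer : (Fin (n H) → Fin (n H) → Bool) → ∀ {x y} → Dec (Preimage x) → Dec (Preimage y) → Bool
  transfer f (yes (u , _)) (yes (w , _)) = f u w
  transfer f _             _             = false

  transfer-emb : ∀ f u w (u? : Dec (Preimage (emb u))) (w? : Dec (Preimage (emb w))) → transfer f u? w? ≡ f u w
  transfer-emb f u w (yes (_ , eu)) (yes (_ , ew)) = cong₂ f (inj eu) (inj ew)
  transfer-emb f u w (yes _)        (no ¬w)        = ⊥-elim (¬w (w , refl))
  transfer-emb f u w (no ¬u)        _              = ⊥-elim (¬u (u , refl))

  transfer-sym : ∀ f → (∀ u w → f u w ≡ f w u) → ∀ {x y} (x? : Dec (Preimage x)) (y? : Dec (Preimage y)) →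
                 transfer f x? y? ≡ transfer f y? x?
  transfer-sym f f-sym (yes (u , _)) (yes (w , _)) = f-sym u w
  transfer-sym f f-sym (yes _)       (no _)        = refl
  transfer-sym f f-sym (no _)        (yes _)       = refl
  transfer-sym f f-sym (no _)        (no _)        = refl

  transfer-bound : ∀ {x y} → x ≢ y → (x? : Dec (Preimage x)) (y? : Dec (Preimage y)) →
    b2n (transfer (straight C) x? y?) + b2n (transfer (cross C) x? y?) ≤ mult G x y
  transfer-bound x≢y (yes (u , refl)) (yes (w , refl)) = ≤-trans (bound C u w (x≢y ∘ cong emb)) (sub u w)
  transfer-bound x≢y (yes _)          (no _)           = z≤n
  transfer-bound x≢y (no _)           _                = z≤n

  extend : Cover G
  extend = record
    { straight = λ x y → transfer (straight C) (preimage? x) (preimage? y)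
    ; cross    = λ x y → transfer (cross C) (preimage? x) (preimage? y)
    ; symS     = λ x y → transfer-sym (straight C) (symS C) (preimage? x) (preimage? y)
    ; symC     = λ x y → transfer-sym (cross C) (symC C) (preimage? x) (preimage? y)
    ; bound    = λ x y x≢y → transfer-bound x≢y (preimage? x) (preimage? y)
    }

  adjℋ-extend : ∀ u w a b → adjℋ C (u , a) (w , b) ≡ adjℋ extend (emb u , a) (emb w , b)
  adjℋ-extend u w a b with u ≟ w
  ... | yes refl = sym (adjℋ-≡ extend (emb u) a b)
  ... | no u≢w   = sym (trans (adjℋ-≢ extend (emb u) (emb w) a b (u≢w ∘ inj))
                              (cong₂ (if a xor b then_else_) (transfer-emb (cross C) u w (preimage? (emb u)) (preimage? (emb w)))
                                                            (transfer-emb (straight C) u w (preimage? (emb u)) (preimage? (emb w)))))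

  restrict : ∀ {i j} → Colorable i j extend → Colorable i j C
  restrict (χ , χ-col) = χ ∘ emb , λ u → ≤-trans (degφ-restrict u) (χ-col (emb u))
    where
      degφ-restrict : ∀ u → degφ C (χ ∘ emb) u ≤ degφ extend χ (emb u)
      degφ-restrict u = begin
        degφ C (χ ∘ emb) u                                             ≡⟨ sum-map-allFin (n H) _ ⟩
        ∑ (λ w → b2n (adjℋ C (u , χ (emb u)) (w , χ (emb w))))
          ≡⟨ sum-cong-≗ (λ w → cong b2n (adjℋ-extend u w (χ (emb u)) (χ (emb w)))) ⟩
        ∑ (λ w → b2n (adjℋ extend (emb u , χ (emb u)) (emb w , χ (emb w))))
          ≤⟨ ∑-reindex-≤ emb inj (λ x → b2n (adjℋ extend (emb u , χ (emb u)) (x , χ x))) ⟩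
        ∑ (λ x → b2n (adjℋ extend (emb u , χ (emb u)) (x , χ x)))     ≡⟨ sum-map-allFin (n G) _ ⟨
        degφ extend χ (emb u)                                          ∎
        where open ≤-Reasoning

  missing-vertex : n H < n G → ∃ λ x → ¬ Preimage x
  missing-vertex smaller = Fin.¬∀⟶∃¬ (n G) Preimage preimage? λ onto →
    <⇒≱ smaller (Fin.injective⇒≤ {f = proj₁ ∘ onto} λ {x} {y} e →
      trans (sym (proj₂ (onto x))) (trans (cong emb e) (proj₂ (onto y))))

  unused-outside : ∀ x → ¬ Preimage x → ∀ y → matchings extend x y ≡ 0
  unused-outside x ¬x y with preimage? x
  ... | yes p = ⊥-elim (¬x p)
  ... | no _  = refl

  extend-deficient : (∀ x → ∃ λ y → 1 ≤ mult G x y) → ∃ λ x → ∃ λ y → Deficient extend x y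
  extend-deficient no-isolated with proper
  ... | inj₁ smaller with missing-vertex smaller
  ...   | x , ¬x with no-isolated x
  ...     | y , edge = x , y , subst (_< mult G x y) (sym (unused-outside x ¬x y)) edge
  extend-deficient no-isolated | inj₂ (u , w , fewer) with u ≟ w
  ... | yes refl = ⊥-elim (n≮0 (subst (mult H u u <_) (noLoop G (emb u)) fewer))
  ... | no u≢w   = emb u , emb w , ≤-<-trans (≤-reflexive image) (≤-<-trans (bound C u w u≢w) fewer)
    where
      image : matchings extend (emb u) (emb w) ≡ matchings C u w
      image = cong₂ (λ s c → b2n s + b2n c)
                (transfer-emb (straight C) u w (preimage? (emb u)) (preimage? (emb w)))
                (transfer-emb (cross C) u w (preimage? (emb u)) (preimage? (emb w)))

proper-subgraphs-colorable : ∀ i j {G} → (∀ x → ∃ λ y → 1 ≤ mult G x y) →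
  (∀ (D : Cover G) x y → Deficient D x y → Colorable i j D) →
  ∀ H → ProperSubgraph H G → (C : Cover H) → Colorable i j C
proper-subgraphs-colorable i j no-isolated deficient-colorable H S C =
  let open Extension S C
      (x , y , def) = extend-deficient no-isolated
  in restrict (deficient-colorable extend x y def)

module Gₘ (j m : ℕ) (1≤m : 1 ≤ m) where

  G : Multigraph
  G = Gm j m

  P : ℕ
  P = pathSize m

  atts : List ℕ
  atts = attachments j m

  N : ℕ
  N = n G

  -- vertex a is junk (fzero) for a ≥ N; every lemma about it assumes a < N.
  opaque
    vertex : ℕ → Fin N
    vertex a with a <? N
    ... | yes a<N = fromℕ< a<N
    ... | no _    = fzero

    toℕ-vertex : ∀ {a} → a < N → toℕ (vertex a) ≡ a
    toℕ-vertex {a} a<N with a <? N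
    ... | yes a<N′ = Fin.toℕ-fromℕ< a<N′
    ... | no  a≮N  = ⊥-elim (a≮N a<N)

  toℕ-path : ∀ {a} → a < P → toℕ (vertex a) ≡ a
  toℕ-path a<P = toℕ-vertex (≤-trans a<P (m≤m+n P (length atts)))

  vertex-toℕ : ∀ x → vertex (toℕ x) ≡ x
  vertex-toℕ x = Fin.toℕ-injective (toℕ-vertex (Fin.toℕ<n x))

  vertex-of : ∀ x {a} → toℕ x ≡ a → x ≡ vertex a
  vertex-of x x≡a = trans (sym (vertex-toℕ x)) (cong vertex x≡a)

  vertex-injective : ∀ {a b} → a < P → b < P → vertex a ≡ vertex b → a ≡ b
  vertex-injective a<P b<P e = trans (sym (toℕ-path a<P)) (trans (cong toℕ e) (toℕ-path b<P))

  toℕ-step : ∀ a → suc a < P → toℕ (vertex (suc a)) ≡ suc (toℕ (vertex a))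
  toℕ-step a 1+a<P = trans (toℕ-path 1+a<P) (cong suc (sym (toℕ-path (<-trans (n<1+n a) 1+a<P))))

  step<P : ∀ a → suc a < P → toℕ (vertex (suc a)) < P
  step<P a 1+a<P = subst (_< P) (sym (toℕ-path 1+a<P)) 1+a<P

  step-≢ : ∀ a → suc a < P → vertex a ≢ vertex (suc a)
  step-≢ a 1+a<P e = 1+n≢n (sym (vertex-injective (<-trans (n<1+n a) 1+a<P) 1+a<P e))

  FlagAt : ℕ → ℕ → Set
  FlagAt p q = P ≤ q × attAt atts (q ∸ P) ≡ p

  flagAt? : ℕ → ℕ → Bool
  flagAt? p q = not (q <ᵇ P) ∧ (attAt atts (q ∸ P) ≡ᵇ p)

  flagAt?-complete : ∀ {p q} → FlagAt p q → flagAt? p q ≡ true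
  flagAt?-complete {p} {q} (P≤q , refl) rewrite <ᵇ-false {q} P≤q = ≡ᵇ-refl p

  flagAt?-sound : ∀ p q → flagAt? p q ≡ true → FlagAt p q
  flagAt?-sound p q e with ∧-true {not (q <ᵇ P)} e
  ... | q≮P , at≡p = <ᵇ-false⇒≥ q P (Bool.not-injective q≮P) , ≡ᵇ-sound _ p at≡p

  data Adjacent (a b : ℕ) : Set where
    path⁺ : b ≡ suc a → b < P → Adjacent a b
    path⁻ : a ≡ suc b → a < P → Adjacent a b
    flag⁺ : a < P → FlagAt a b → Adjacent a b
    flag⁻ : b < P → FlagAt b a → Adjacent a b

  halfMult-pos : ∀ a b → 1 ≤ halfMult j m a b → (b ≡ suc a × b < P) ⊎ (a < P × FlagAt a b)
  halfMult-pos a b h with (b ≡ᵇ suc a) ∧ (b <ᵇ P) in e₁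
  ... | true = inj₁ (≡ᵇ-sound b (suc a) (proj₁ (∧-true e₁)) , <ᵇ-sound b P (proj₂ (∧-true e₁)))
  ... | false with (a <ᵇ P) ∧ flagAt? a b in e₂
  ...   | true  = inj₂ (<ᵇ-sound a P (proj₁ (∧-true {a <ᵇ P} e₂)) , flagAt?-sound a b (proj₂ (∧-true {a <ᵇ P} e₂)))
  ...   | false with () ← h

  adjacent : ∀ x y → 1 ≤ mult G x y → Adjacent (toℕ x) (toℕ y)
  adjacent x y h with halfMult j m (toℕ x) (toℕ y) in e
  ... | suc _ with halfMult-pos (toℕ x) (toℕ y) (subst (1 ≤_) (sym e) (s≤s z≤n))
  ...   | inj₁ (y≡1+x , y<P)   = path⁺ y≡1+x y<P
  ...   | inj₂ (x<P , flag)    = flag⁺ x<P flag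
  adjacent x y h | zero with halfMult-pos (toℕ y) (toℕ x) h
  ...   | inj₁ (x≡1+y , x<P)   = path⁻ x≡1+y x<P
  ...   | inj₂ (y<P , flag)    = flag⁻ y<P flag

  halfMult-step : ∀ a → suc a < P → halfMult j m a (suc a) ≡ 1
  halfMult-step a 1+a<P rewrite ≡ᵇ-refl a | <ᵇ-true 1+a<P = refl

  halfMult-step-back : ∀ a → suc a < P → halfMult j m (suc a) a ≡ 0
  halfMult-step-back a 1+a<P
    rewrite ≡ᵇ-false a (suc (suc a)) (<⇒≢ (<-trans (n<1+n a) (n<1+n (suc a)))) | <ᵇ-true 1+a<P
          | <ᵇ-true (<-trans (n<1+n a) 1+a<P) = refl

  halfMult-flag : ∀ p q → p < P → FlagAt p q → halfMult j m p q ≡ 2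
  halfMult-flag p q p<P (P≤q , at≡p)
    rewrite <ᵇ-false {q} P≤q | Bool.∧-zeroʳ (q ≡ᵇ suc p) | <ᵇ-true p<P | at≡p | ≡ᵇ-refl p = refl

  halfMult-flag-back : ∀ p q → p < P → P ≤ q → halfMult j m q p ≡ 0
  halfMult-flag-back p q p<P P≤q
    rewrite <ᵇ-false {q} P≤q | ≡ᵇ-false p (suc q) (<⇒≢ (<-≤-trans p<P (≤-trans P≤q (n≤1+n q)))) = refl

  mult-path : ∀ x y → toℕ y ≡ suc (toℕ x) → toℕ y < P → mult G x y ≡ 1
  mult-path x y y≡1+x y<P =
    subst (λ b → halfMult j m (toℕ x) b + halfMult j m b (toℕ x) ≡ 1) (sym y≡1+x)
      (cong₂ _+_ (halfMult-step (toℕ x) y<P′) (halfMult-step-back (toℕ x) y<P′))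
    where y<P′ = subst (_< P) y≡1+x y<P

  mult-flag : ∀ x y → toℕ x < P → FlagAt (toℕ x) (toℕ y) → mult G x y ≡ 2
  mult-flag x y x<P flag =
    cong₂ _+_ (halfMult-flag (toℕ x) (toℕ y) x<P flag) (halfMult-flag-back (toℕ x) (toℕ y) x<P (proj₁ flag))


  mult-step : ∀ a → suc a < P → mult G (vertex a) (vertex (suc a)) ≡ 1
  mult-step a 1+a<P = mult-path (vertex a) (vertex (suc a)) (toℕ-step a 1+a<P) (step<P a 1+a<P)

  EvenUpTo2m : ℕ → Set
  EvenUpTo2m a = ∃ λ u → u ≤ m × a ≡ 2 * u

  attachment-even : ∀ k → EvenUpTo2m (attAt atts k)
  attachment-even = All-attAt {Q = EvenUpTo2m} (0 , z≤n , refl) all-even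
    where
      interior : ∀ {t} → t < m ∸ 1 → EvenUpTo2m (2 * suc t)
      interior {t} t<m∸1 = suc t , ≤-trans t<m∸1 (m∸n≤m m 1) , refl
      all-even : All EvenUpTo2m atts
      all-even =
        All.++⁺ (All.replicate⁺ j (0 , z≤n , refl))
        (All.++⁺ (All.replicate⁺ j (m , ≤-refl , refl))
                 (All.concat⁺ (All.map⁺ {f = λ t → replicate (j ∸ 1) (2 * suc t)}
                   (All.applyUpTo⁺₁ (λ t → t) (m ∸ 1) (All.replicate⁺ (j ∸ 1) ∘ interior)))))

  attachment<P : ∀ k → attAt atts k < P
  attachment<P k with attachment-even k
  ... | u , u≤m , at≡2u = subst (_< P) (sym at≡2u) (s≤s (*-monoʳ-≤ 2 u≤m))

  no-isolated : ∀ x → ∃ λ y → 1 ≤ mult G x y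
  no-isolated x with toℕ x <? P
  ... | no x≮P = vertex w , subst (1 ≤_) (sym (trans (symm G x (vertex w)) (mult-flag (vertex w) x w<P′ flag))) (s≤s z≤n)
    where
      w = attAt atts (toℕ x ∸ P)
      w<P = attachment<P (toℕ x ∸ P)
      w<P′ = subst (_< P) (sym (toℕ-path w<P)) w<P
      flag : FlagAt (toℕ (vertex w)) (toℕ x)
      flag = ≮⇒≥ x≮P , sym (toℕ-path w<P)
  ... | yes x<P with suc (toℕ x) <? P
  ...   | yes 1+x<P = vertex (suc (toℕ x)) , ≤-reflexive (sym (mult-path x _ (toℕ-path 1+x<P) right<P))
    where right<P = subst (_< P) (sym (toℕ-path 1+x<P)) 1+x<P
  ...   | no 1+x≮P = vertex a , ≤-reflexive (sym (trans (symm G x (vertex a)) (mult-path (vertex a) x x≡a+1 x<P)))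
    where
      a = pred (toℕ x)
      x≥1 : 1 ≤ toℕ x
      x≥1 = ≤-trans (≤-trans 1≤m (m≤m+n m _)) (s≤s⁻¹ (≮⇒≥ 1+x≮P))
      a<P = <-trans (n<1+n a) (subst (_< P) (sym (suc-pred (toℕ x) {{>-nonZero x≥1}})) x<P)
      x≡a+1 = trans (sym (suc-pred (toℕ x) {{>-nonZero x≥1}})) (cong suc (sym (toℕ-path a<P)))

  occurrences-atts : ∀ p → occurrences p atts ≡
    j * b2n (0 ≡ᵇ p) + (j * b2n (2 * m ≡ᵇ p) + ∑< (m ∸ 1) (λ t → (j ∸ 1) * b2n (2 * suc t ≡ᵇ p)))
  occurrences-atts p =
    trans (occurrences-++ p (replicate j 0) _)
    (cong₂ _+_ (occurrences-replicate p j 0)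
      (trans (occurrences-++ p (replicate j (2 * m)) _)
        (cong₂ _+_ (occurrences-replicate p j (2 * m))
          (trans (occurrences-concatMap p (λ t → replicate (j ∸ 1) (2 * suc t)) (m ∸ 1) (λ t → t))
                 (∑<-cong (m ∸ 1) (λ t _ → occurrences-replicate p (j ∸ 1) (2 * suc t)))))))

  flags-at-start : occurrences 0 atts ≡ j
  flags-at-start = begin
    occurrences 0 atts                 ≡⟨ occurrences-atts 0 ⟩
    _                                  ≡⟨ cong₂ _+_ (*-b2n-≡ᵇ-refl j 0)
                                            (cong₂ _+_ (*-b2n-≡ᵇ-≢ j 2m≢0)
                                                       (∑<-vanish (m ∸ 1) (λ t _ → *-b2n-≡ᵇ-≢ (j ∸ 1) {2 * suc t} {0} λ ()))) ⟩
    j + 0                              ≡⟨ +-identityʳ j ⟩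
    j                                  ∎
    where
      open ≡-Reasoning
      2m≢0 : 2 * m ≢ 0
      2m≢0 = ≢-sym (<⇒≢ (≤-trans 1≤m (m≤m+n m _)))

  flags-at-end : occurrences (2 * m) atts ≡ j
  flags-at-end = begin
    occurrences (2 * m) atts           ≡⟨ occurrences-atts (2 * m) ⟩
    _                                  ≡⟨ cong₂ _+_ (*-b2n-≡ᵇ-≢ j {0} {2 * m} 0≢2m)
                                            (cong₂ _+_ (*-b2n-≡ᵇ-refl j (2 * m)) (∑<-vanish (m ∸ 1) before-end)) ⟩
    j + 0                              ≡⟨ +-identityʳ j ⟩
    j                                  ∎
    where
      open ≡-Reasoning
      0≢2m : 0 ≢ 2 * m
      0≢2m = <⇒≢ (≤-trans 1≤m (m≤m+n m _))
      before-end : ∀ t → t < m ∸ 1 → (j ∸ 1) * b2n (2 * suc t ≡ᵇ 2 * m) ≡ 0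
      before-end t t<m∸1 = *-b2n-≡ᵇ-≢ (j ∸ 1) λ e →
        <⇒≢ (<-≤-trans (s≤s t<m∸1) (≤-reflexive (trans (+-comm 1 (m ∸ 1)) (m∸n+n≡m 1≤m))))
            (*-cancelˡ-≡ (suc t) m 2 e)

  flags-interior : ∀ u → 0 < u → u < m → occurrences (2 * u) atts ≡ j ∸ 1
  flags-interior (suc c) _ u<m = begin
    occurrences (2 * suc c) atts       ≡⟨ occurrences-atts (2 * suc c) ⟩
    _                                  ≡⟨ cong₂ _+_ (*-b2n-≡ᵇ-≢ j {0} {2 * suc c} λ ())
                                            (cong₂ _+_ (*-b2n-≡ᵇ-≢ j {2 * m} {2 * suc c} (λ e → <⇒≢ u<m (sym (*-cancelˡ-≡ m (suc c) 2 e))))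
                                                       (∑<-point (m ∸ 1) c c<m∸1 others)) ⟩
    (j ∸ 1) * b2n (2 * suc c ≡ᵇ 2 * suc c) ≡⟨ *-b2n-≡ᵇ-refl (j ∸ 1) (2 * suc c) ⟩
    j ∸ 1                              ∎
    where
      open ≡-Reasoning
      c<m∸1 : c < m ∸ 1
      c<m∸1 = ∸-monoˡ-≤ 1 u<m
      others : ∀ t → t < m ∸ 1 → t ≢ c → (j ∸ 1) * b2n (2 * suc t ≡ᵇ 2 * suc c) ≡ 0
      others t _ t≢c = *-b2n-≡ᵇ-≢ (j ∸ 1) (t≢c ∘ suc-injective ∘ *-cancelˡ-≡ (suc t) (suc c) 2)

  ∑-flagAt : ∀ p → ∑ {N} (λ x → b2n (flagAt? p (toℕ x))) ≡ occurrences p atts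
  ∑-flagAt p = begin
    ∑ {N} (λ x → b2n (flagAt? p (toℕ x)))                                ≡⟨ ∑-toℕ N (b2n ∘ flagAt? p) ⟩
    ∑< (P + length atts) (b2n ∘ flagAt? p)                               ≡⟨ ∑<-split P (length atts) (b2n ∘ flagAt? p) ⟩
    ∑< P (b2n ∘ flagAt? p) + ∑< (length atts) (λ k → b2n (flagAt? p (P + k)))
      ≡⟨ cong₂ _+_ (∑<-vanish P path-vertex) (∑<-cong (length atts) flag-vertex) ⟩
    ∑< (length atts) (λ k → b2n (attAt atts k ≡ᵇ p))                     ≡⟨ ∑<-attAt p atts ⟩
    occurrences p atts                                                   ∎
    where
      open ≡-Reasoning
      path-vertex : ∀ q → q < P → b2n (flagAt? p q) ≡ 0
      path-vertex q q<P rewrite <ᵇ-true q<P = refl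
      flag-vertex : ∀ k → k < length atts → b2n (flagAt? p (P + k)) ≡ b2n (attAt atts k ≡ᵇ p)
      flag-vertex k _ rewrite <ᵇ-false {P + k} (m≤m+n P k) | m+n∸m≡n P k = refl

  degφ-≤-Adjacent : ∀ (C : Cover G) φ v (g : Fin N → ℕ) →
    (∀ x → Adjacent (toℕ v) (toℕ x) → adjℋ C (v , φ v) (x , φ x) ≡ true → 1 ≤ g x) → degφ C φ v ≤ ∑ g
  degφ-≤-Adjacent C φ v g adj⇒g = degφ-≤ C φ v g λ x adj → adj⇒g x (adjacent v x (adjℋ⇒edge C φ v x adj)) adj

  δ-vertex : ∀ x {b} c → toℕ x ≡ b → δ (vertex b) x c ≡ c
  δ-vertex x c x≡b = subst (λ y → δ y x c ≡ c) (vertex-of x x≡b) (δ-self x c)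

  at-vertex : ∀ x {b} → toℕ x ≡ b → 1 ≤ δ (vertex b) x 1
  at-vertex x x≡b = ≤-reflexive (sym (δ-vertex x 1 x≡b))

  flag-degφ≤1 : ∀ (C : Cover G) φ x → P ≤ toℕ x → degφ C φ x ≤ 1
  flag-degφ≤1 C φ x P≤x = ≤-trans (degφ-≤-Adjacent C φ x (λ y → δ (vertex w) y 1) attachment-only)
                                  (≤-reflexive (∑-δ (vertex w) (λ _ → 1)))
    where
      w = attAt atts (toℕ x ∸ P)
      attachment-only : ∀ y → Adjacent (toℕ x) (toℕ y) → adjℋ C (x , φ x) (y , φ y) ≡ true → 1 ≤ δ (vertex w) y 1
      attachment-only y (path⁺ y≡1+x y<P) _ = ⊥-elim (<⇒≱ (subst (_< P) y≡1+x y<P) (≤-trans P≤x (n≤1+n _)))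
      attachment-only y (path⁻ _ x<P)     _ = ⊥-elim (<⇒≱ x<P P≤x)
      attachment-only y (flag⁺ x<P _)     _ = ⊥-elim (<⇒≱ x<P P≤x)
      attachment-only y (flag⁻ _ (_ , at≡y)) _ = at-vertex y (sym at≡y)

  odd-degφ≤2 : ∀ (C : Cover G) φ s → suc (2 * s) < P → degφ C φ (vertex (suc (2 * s))) ≤ 2
  odd-degφ≤2 C φ s q<P = ≤-trans (degφ-≤-Adjacent C φ x (λ y → δ (vertex (suc q)) y 1 + δ (vertex (2 * s)) y 1) path-only)
                                 (≤-reflexive (trans (∑-distrib-+ (λ y → δ (vertex (suc q)) y 1) (λ y → δ (vertex (2 * s)) y 1))
                                                     (cong₂ _+_ (∑-δ (vertex (suc q)) (λ _ → 1)) (∑-δ (vertex (2 * s)) (λ _ → 1)))))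
    where
      q = suc (2 * s)
      x = vertex q
      x≡q = toℕ-path q<P
      path-only : ∀ y → Adjacent (toℕ x) (toℕ y) → adjℋ C (x , φ x) (y , φ y) ≡ true →
                  1 ≤ δ (vertex (suc q)) y 1 + δ (vertex (2 * s)) y 1
      path-only y (path⁺ y≡1+x _)  _ = ≤-trans (at-vertex y (trans y≡1+x (cong suc x≡q))) (m≤m+n _ _)
      path-only y (path⁻ x≡1+y _)  _ = ≤-trans (at-vertex y (suc-injective (trans (sym x≡1+y) x≡q))) (m≤n+m _ _)
      path-only y (flag⁺ _ (_ , at≡x)) _ with attachment-even (toℕ y ∸ P)
      ... | u , _ , at≡2u = ⊥-elim (even≢odd u s (trans (sym at≡2u) (trans at≡x x≡q)))
      path-only y (flag⁻ _ (P≤x , _)) _ = ⊥-elim (<⇒≱ q<P (subst (P ≤_) x≡q P≤x))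

-- A cover of G_m without (i,j)-colouring

module Obstruction (i j m : ℕ) (i+2≤j : i + 2 ≤ j) (1≤m : 1 ≤ m) where
  open Gₘ j m 1≤m

  straight? cross? : ℕ → Bool → Bool
  straight? M e = (M ≡ᵇ 2) ∨ ((M ≡ᵇ 1) ∧ e)
  cross?    M e = (M ≡ᵇ 2) ∨ ((M ≡ᵇ 1) ∧ not e)

  alternating-bound : ∀ M e → b2n (straight? M e) + b2n (cross? M e) ≤ M
  alternating-bound zero                e     = z≤n
  alternating-bound (suc zero)          true  = ≤-refl
  alternating-bound (suc zero)          false = ≤-refl
  alternating-bound (suc (suc zero))    e     = ≤-refl
  alternating-bound (suc (suc (suc M))) e     = z≤n

  alternating : Cover G
  alternating = record
    { straight = λ x y → straight? (mult G x y) (even? (toℕ x ⊓ toℕ y))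
    ; cross    = λ x y → cross? (mult G x y) (even? (toℕ x ⊓ toℕ y))
    ; symS     = λ x y → cong₂ straight? (symm G x y) (cong even? (⊓-comm (toℕ x) (toℕ y)))
    ; symC     = λ x y → cong₂ cross? (symm G x y) (cong even? (⊓-comm (toℕ x) (toℕ y)))
    ; bound    = λ x y _ → alternating-bound (mult G x y) (even? (toℕ x ⊓ toℕ y))
    }

  alternating-flag : ∀ v x a b → toℕ v < P → FlagAt (toℕ v) (toℕ x) → adjℋ alternating (v , a) (x , b) ≡ true
  alternating-flag v x a b v<P flag
    rewrite adjℋ-≢ alternating v x a b (λ { refl → <⇒≱ v<P (proj₁ flag) }) | mult-flag v x v<P flag with a xor b
  ... | true  = refl
  ... | false = refl

  alternating-path : ∀ x y a b → toℕ y ≡ suc (toℕ x) → toℕ y < P →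
    adjℋ alternating (x , a) (y , b) ≡ (if a xor b then not (even? (toℕ x)) else even? (toℕ x))
  alternating-path x y a b y≡1+x y<P
    rewrite adjℋ-≢ alternating x y a b (λ { refl → 1+n≢n (sym y≡1+x) }) | mult-path x y y≡1+x y<P
          | m≤n⇒m⊓n≡m (subst (toℕ x ≤_) (sym y≡1+x) (n≤1+n (toℕ x))) with a xor b
  ... | true  = refl
  ... | false = refl

  1<P : 1 < P
  1<P = s≤s (≤-trans 1≤m (m≤m+n m _))

  i<j∸1 : i < j ∸ 1
  i<j∸1 = ∸-monoˡ-≤ 1 (subst (_≤ j) (+-comm i 2) i+2≤j)

  i<j : i < j
  i<j = ≤-trans i<j∸1 (m∸n≤m j 1)

  module _ (φ : HMap G) (φ-col : IsColoring i j alternating φ) where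

    A : Fin N → Fin N → ℕ
    A v x = b2n (adjℋ alternating (v , φ v) (x , φ x))

    flags+two≤degφ : ∀ a b c → a < P → b < P → c < P → b ≢ c →
      occurrences a atts + A (vertex a) (vertex b) + A (vertex a) (vertex c) ≤ degφ alternating φ (vertex a)
    flags+two≤degφ a b c a<P b<P c<P b≢c = begin
      occurrences a atts + A v y + A v z
        ≡⟨ cong₂ (λ s t → s + t + A v z) (sym (∑-flagAt a)) (sym (∑-δ y (A v))) ⟩
      ∑ F + ∑ (λ x → δ y x (A v x)) + A v z
        ≡⟨ cong (∑ F + ∑ (λ x → δ y x (A v x)) +_) (sym (∑-δ z (A v))) ⟩
      ∑ F + ∑ (λ x → δ y x (A v x)) + ∑ (λ x → δ z x (A v x))
        ≡⟨ cong (_+ ∑ (λ x → δ z x (A v x))) (∑-distrib-+ F (λ x → δ y x (A v x))) ⟨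
      ∑ (λ x → F x + δ y x (A v x)) + ∑ (λ x → δ z x (A v x))
        ≡⟨ ∑-distrib-+ (λ x → F x + δ y x (A v x)) (λ x → δ z x (A v x)) ⟨
      ∑ (λ x → F x + δ y x (A v x) + δ z x (A v x))
        ≤⟨ ∑-mono-≤ pointwise ⟩
      ∑ (A v)
        ≡⟨ sum-map-allFin N (A v) ⟨
      degφ alternating φ v ∎
      where
        open ≤-Reasoning
        v = vertex a
        y = vertex b
        z = vertex c
        F : Fin N → ℕ
        F x = b2n (flagAt? a (toℕ x))
        path≢flag : ∀ {d} x → d < P → P ≤ toℕ x → vertex d ≢ x
        path≢flag x d<P P≤x refl = <⇒≱ (subst (_< P) (sym (toℕ-path d<P)) d<P) P≤x
        pointwise : ∀ x → F x + δ y x (A v x) + δ z x (A v x) ≤ A v x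
        pointwise x with flagAt? a (toℕ x) in flag?
        ... | false = δ-two x (A v x) (b≢c ∘ vertex-injective b<P c<P)
        ... | true  = ≤-reflexive (begin-equality
              1 + δ y x (A v x) + δ z x (A v x)
                ≡⟨ cong₂ (λ s t → 1 + s + t) (δ-≢ (A v x) (path≢flag x b<P P≤x)) (δ-≢ (A v x) (path≢flag x c<P P≤x)) ⟩
              1 ≡⟨ cong b2n (alternating-flag v x (φ v) (φ x) v<P (P≤x , trans at≡a (sym (toℕ-path a<P)))) ⟨
              A v x ∎)
          where
            P≤x = proj₁ (flagAt?-sound a (toℕ x) flag?)
            at≡a = proj₂ (flagAt?-sound a (toℕ x) flag?)
            v<P = subst (_< P) (sym (toℕ-path a<P)) a<P

    degφ≤j : ∀ v → φ v ≡ true → degφ alternating φ v ≤ j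
    degφ≤j v rich = subst (λ b → degφ alternating φ v ≤ (if b then j else i)) rich (φ-col v)

    rich-if-crowded : ∀ a → a < P → i < occurrences a atts → φ (vertex a) ≡ true
    rich-if-crowded a a<P i<occ with φ (vertex a) in φa
    ... | true  = refl
    ... | false = ⊥-elim (<⇒≱ i<occ (begin
      occurrences a atts                                          ≤⟨ m≤m+n _ _ ⟩
      occurrences a atts + A (vertex a) (vertex 0)                ≤⟨ m≤m+n _ _ ⟩
      occurrences a atts + A (vertex a) (vertex 0) + A (vertex a) (vertex 1)
        ≤⟨ flags+two≤degφ a 0 1 a<P z<s 1<P (λ ()) ⟩
      degφ alternating φ (vertex a)
        ≤⟨ subst (λ b → degφ alternating φ (vertex a) ≤ (if b then j else i)) φa (φ-col (vertex a)) ⟩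
      i                                                           ∎))
      where open ≤-Reasoning

    path-adj : ∀ a → suc a < P →
      A (vertex a) (vertex (suc a)) ≡ b2n (if φ (vertex a) xor φ (vertex (suc a)) then not (even? a) else even? a)
    path-adj a 1+a<P = cong b2n (trans
      (alternating-path (vertex a) (vertex (suc a)) (φ (vertex a)) (φ (vertex (suc a))) (toℕ-step a 1+a<P) (step<P a 1+a<P))
      (cong (λ e → if φ (vertex a) xor φ (vertex (suc a)) then not (even? e) else even? e)
            (toℕ-path (<-trans (n<1+n a) 1+a<P))))

    poor-after-rich : ∀ a → suc a < P → even? a ≡ true → φ (vertex a) ≡ true →
                      A (vertex a) (vertex (suc a)) ≡ 0 → φ (vertex (suc a)) ≡ false
    poor-after-rich a 1+a<P a-even rich no-adj = Bool.¬-not λ φ′ → 0≢1+n (trans (sym no-adj)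
      (trans (path-adj a 1+a<P) (trans
        (cong₂ (λ p q → b2n (if p xor q then not (even? a) else even? a)) rich φ′) (cong b2n a-even))))

    adjacent-after-poor : ∀ a → suc a < P → even? a ≡ false → φ (vertex a) ≡ false →
                          φ (vertex (suc a)) ≡ true → A (vertex (suc a)) (vertex a) ≡ 1
    adjacent-after-poor a 1+a<P a-odd poor rich = begin
      A (vertex (suc a)) (vertex a)   ≡⟨ cong b2n (adjℋ-sym alternating (vertex (suc a)) (vertex a) (φ (vertex (suc a))) (φ (vertex a))) ⟩
      A (vertex a) (vertex (suc a))   ≡⟨ path-adj a 1+a<P ⟩
      b2n (if φ (vertex a) xor φ (vertex (suc a)) then not (even? a) else even? a)
        ≡⟨ cong₂ (λ p q → b2n (if p xor q then not (even? a) else even? a)) poor rich ⟩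
      b2n (not (even? a))             ≡⟨ cong (b2n ∘ not) a-odd ⟩
      1                               ∎
      where open ≡-Reasoning

    odd-poor : ∀ s → s < m → φ (vertex (suc (2 * s))) ≡ false
    odd-poor zero _ = poor-after-rich 0 1<P refl rich (m+n≤m⇒n≡0 j (m+n≤o⇒m≤o (j + A v₀ v₁) degree-bound))
      where
        v₀ = vertex 0
        v₁ = vertex 1
        occ = flags-at-start
        rich = rich-if-crowded 0 z<s (subst (i <_) (sym occ) i<j)
        degree-bound : j + A v₀ v₁ + A v₀ v₀ ≤ j
        degree-bound = subst (λ k → k + A v₀ v₁ + A v₀ v₀ ≤ j) occ
                  (≤-trans (flags+two≤degφ 0 1 0 z<s 1<P z<s (λ ())) (degφ≤j v₀ rich))
    odd-poor (suc s) 1+s<m = subst (λ z → φ (vertex (suc z)) ≡ false) (sym (*-suc 2 s))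
      (poor-after-rich a 1+a<P a-even rich (m+n≤m⇒n≡0 j (subst (_≤ j) j∸1+1≡j degree-bound)))
      where
        a = suc (suc (2 * s))
        a<P : a < P
        a<P = subst (_< P) (*-suc 2 s) (s≤s (*-monoʳ-≤ 2 (<⇒≤ 1+s<m)))
        1+a<P : suc a < P
        1+a<P = s≤s (subst (λ z → suc z ≤ 2 * m) (*-suc 2 s) (*-monoʳ-< 2 1+s<m))
        a-even : even? a ≡ true
        a-even = trans (Bool.not-involutive _) (even?-even s)
        occ : occurrences a atts ≡ j ∸ 1
        occ = subst (λ z → occurrences z atts ≡ j ∸ 1) (*-suc 2 s) (flags-interior (suc s) z<s 1+s<m)
        rich = rich-if-crowded a a<P (subst (i <_) (sym occ) i<j∸1)
        left : A (vertex a) (vertex (suc (2 * s))) ≡ 1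
        left = adjacent-after-poor (suc (2 * s)) a<P (even?-odd s) (odd-poor s (<-trans (n<1+n s) 1+s<m)) rich
        degree-bound : j ∸ 1 + 1 + A (vertex a) (vertex (suc a)) ≤ j
        degree-bound = subst₂ (λ k l → k + l + A (vertex a) (vertex (suc a)) ≤ j) occ left
                  (≤-trans (flags+two≤degφ a (suc (2 * s)) (suc a) a<P (<-trans (n<1+n _) a<P) 1+a<P
                             (<⇒≢ (<-trans (n<1+n _) (n<1+n _))))
                           (degφ≤j (vertex a) rich))
        j∸1+1≡j : j ∸ 1 + 1 + A (vertex a) (vertex (suc a)) ≡ j + A (vertex a) (vertex (suc a))
        j∸1+1≡j = cong (_+ A (vertex a) (vertex (suc a))) (m∸n+n≡m (≤-trans (s≤s z≤n) i<j))

    last-overloaded : ⊥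
    last-overloaded = m+1+n≰m j (subst (_≤ j) (+-assoc j 1 (A (vertex a) (vertex a))) degree-bound)
      where
        s = pred m
        a = suc (suc (2 * s))
        1+s≡m : suc s ≡ m
        1+s≡m = suc-pred m {{>-nonZero 1≤m}}
        a≡2m : a ≡ 2 * m
        a≡2m = trans (sym (*-suc 2 s)) (cong (2 *_) 1+s≡m)
        a<P : a < P
        a<P = subst (_< P) (sym a≡2m) (n<1+n (2 * m))
        occ : occurrences a atts ≡ j
        occ = subst (λ z → occurrences z atts ≡ j) (sym a≡2m) (flags-at-end)
        rich = rich-if-crowded a a<P (subst (i <_) (sym occ) i<j)
        left : A (vertex a) (vertex (suc (2 * s))) ≡ 1
        left = adjacent-after-poor (suc (2 * s)) a<P (even?-odd s) (odd-poor s (subst (s <_) 1+s≡m (n<1+n s))) rich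
        degree-bound : j + 1 + A (vertex a) (vertex a) ≤ j
        degree-bound = subst₂ (λ k l → k + l + A (vertex a) (vertex a) ≤ j) occ left
                  (≤-trans (flags+two≤degφ a (suc (2 * s)) a a<P (<-trans (n<1+n _) a<P) a<P (≢-sym 1+n≢n))
                           (degφ≤j (vertex a) rich))

  alternating-not-colorable : ¬ Colorable i j alternating
  alternating-not-colorable (φ , φ-col) = last-overloaded φ φ-col

-- Colouring deficient covers of G_m

module Repair (i j m : ℕ) (2≤i : 2 ≤ i) (i≤j : i ≤ j) (1≤m : 1 ≤ m) (D : Cover (Gm j m)) where
  open Gₘ j m 1≤m

  evenEnd : ℕ → Bool → ℕ
  evenEnd s right = if right then suc (suc (2 * s)) else 2 * s

  data Defect : Set where
    flag-defect : ∀ k → k ≤ m → (d : Fin N) → FlagAt (2 * k) (toℕ d) →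
                  straight D (vertex (2 * k)) d ∧ cross D (vertex (2 * k)) d ≡ false → Defect
    path-defect : ∀ s → s < m → (right : Bool) →
                  straight D (vertex (evenEnd s right)) (vertex (suc (2 * s))) ≡ false →
                  cross D (vertex (evenEnd s right)) (vertex (suc (2 * s))) ≡ false → Defect

  position : Defect → ℕ
  position (flag-defect k _ _ _ _)   = 2 * k
  position (path-defect s _ _ _ _)   = suc (2 * s)

  rightward : Defect → Bool
  rightward (flag-defect _ _ _ _ _)     = false
  rightward (path-defect _ _ right _ _) = right

  empty-edge : ∀ def s → suc (2 * s) ≡ position def →
    straight D (vertex (evenEnd s (rightward def))) (vertex (suc (2 * s))) ≡ false ×
    cross D (vertex (evenEnd s (rightward def))) (vertex (suc (2 * s))) ≡ false
  empty-edge (flag-defect k _ _ _ _) s odd≡even = ⊥-elim (even≢odd k s (sym odd≡even))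
  empty-edge (path-defect s′ _ _ s≡ c≡) s odd≡odd with *-cancelˡ-≡ s s′ 2 (suc-injective odd≡odd)
  ... | refl = s≡ , c≡

  from-path-edge : ∀ x y a → toℕ x ≡ a → toℕ y ≡ suc a → suc a < P →
                   straight D x y ≡ false × cross D x y ≡ false → Defect
  from-path-edge x y a x≡a y≡1+a 1+a<P (s≡ , c≡) with parity a
  ... | even s = path-defect s (*-cancelˡ-< 2 s m (s<s⁻¹ 1+a<P)) false
                   (subst₂ (λ u w → straight D u w ≡ false) x≡ y≡ s≡)
                   (subst₂ (λ u w → cross D u w ≡ false) x≡ y≡ c≡)
    where
      x≡ = vertex-of x x≡a
      y≡ = vertex-of y y≡1+a
  ... | odd s = path-defect s (*-cancelˡ-< 2 s m (<-trans (n<1+n _) (s<s⁻¹ 1+a<P))) true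
                  (subst₂ (λ u w → straight D u w ≡ false) y≡ x≡ (trans (symS D y x) s≡))
                  (subst₂ (λ u w → cross D u w ≡ false) y≡ x≡ (trans (symC D y x) c≡))
    where
      x≡ = vertex-of x x≡a
      y≡ = vertex-of y y≡1+a

  from-flag-edge : ∀ x y → toℕ x < P → FlagAt (toℕ x) (toℕ y) → straight D x y ∧ cross D x y ≡ false → Defect
  from-flag-edge x y x<P (P≤y , at≡x) not-both-used with attachment-even (toℕ y ∸ P)
  ... | k , k≤m , at≡2k = flag-defect k k≤m y (P≤y , at≡2k)
                            (subst (λ u → straight D u y ∧ cross D u y ≡ false) x≡ not-both-used)
    where x≡ = vertex-of x (trans (sym at≡x) at≡2k)

  defect : ∀ x y → Deficient D x y → Defect
  defect x y def with adjacent x y (≤-trans (s≤s z≤n) def)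
  ... | path⁺ y≡1+x y<P = from-path-edge x y (toℕ x) refl y≡1+x (subst (_< P) y≡1+x y<P)
                            (none-used (subst (matchings D x y <_) (mult-path x y y≡1+x y<P) def))
  ... | path⁻ x≡1+y x<P = from-path-edge y x (toℕ y) refl x≡1+y (subst (_< P) x≡1+y x<P)
                            (none-used (subst (matchings D y x <_) (mult-path y x x≡1+y x<P) (Deficient-sym D def)))
  ... | flag⁺ x<P flag  = from-flag-edge x y x<P flag (not-both {straight D x y} (subst (matchings D x y <_) (mult-flag x y x<P flag) def))
  ... | flag⁻ y<P flag  = from-flag-edge y x y<P flag
                            (not-both {straight D y x} (subst (matchings D y x <_) (mult-flag y x y<P flag) (Deficient-sym D def)))

  defect-flag : Defect → ℕ → Fin N → ℕ
  defect-flag (flag-defect k _ d _ _) p x = δ d x (b2n (p ≡ᵇ 2 * k))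
  defect-flag (path-defect _ _ _ _ _) p x = 0

  flag-defect-at : Defect → ℕ → ℕ
  flag-defect-at (flag-defect k _ _ _ _) p = b2n (p ≡ᵇ 2 * k)
  flag-defect-at (path-defect _ _ _ _ _) p = 0

  ∑-defect-flag : ∀ def p → ∑ (defect-flag def p) ≡ flag-defect-at def p
  ∑-defect-flag (flag-defect k _ d _ _) p = ∑-δ d (λ _ → b2n (p ≡ᵇ 2 * k))
  ∑-defect-flag (path-defect _ _ _ _ _) p = sum-replicate-zero N

  defect-flag-off : ∀ def p x → flagAt? p (toℕ x) ≡ false → defect-flag def p x ≡ 0
  defect-flag-off (path-defect _ _ _ _ _) p x _ = refl
  defect-flag-off (flag-defect k _ d flag _) p x not-flag with d ≟ x | p ≡ᵇ 2 * k in p≡ᵇ2k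
  ... | no _     | _     = refl
  ... | yes _    | false = refl
  ... | yes refl | true  = ⊥-elim (true≢false
    (flagAt?-complete (subst (λ q → FlagAt q (toℕ d)) (sym (≡ᵇ-sound p _ p≡ᵇ2k)) flag)) not-flag)

  defect-flag-≤ : ∀ def p x → b2n (straight D (vertex p) x ∧ cross D (vertex p) x) + defect-flag def p x ≤ 1
  defect-flag-≤ (path-defect _ _ _ _ _) p x = ≤-trans (≤-reflexive (+-identityʳ _)) (b2n≤1 _)
  defect-flag-≤ (flag-defect k _ d _ unused) p x with d ≟ x | p ≡ᵇ 2 * k in p≡ᵇ2k
  ... | no _     | _     = ≤-trans (≤-reflexive (+-identityʳ _)) (b2n≤1 _)
  ... | yes _    | false = ≤-trans (≤-reflexive (+-identityʳ _)) (b2n≤1 _)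
  ... | yes refl | true  = ≤-reflexive (cong (λ b → b2n b + 1)
    (subst (λ q → straight D (vertex q) d ∧ cross D (vertex q) d ≡ false) (sym (≡ᵇ-sound p _ p≡ᵇ2k)) unused))

  position≤2m : ∀ def → position def ≤ 2 * m
  position≤2m (flag-defect k k≤m _ _ _) = *-monoʳ-≤ 2 k≤m
  position≤2m (path-defect s s<m _ _ _) = *-monoʳ-< 2 s<m

  flag-defect-here : ∀ def u → position def ≡ 2 * u → flag-defect-at def (2 * u) ≡ 1
  flag-defect-here (flag-defect k _ _ _ _) u 2k≡2u = cong b2n (trans (cong (2 * u ≡ᵇ_) 2k≡2u) (≡ᵇ-refl (2 * u)))
  flag-defect-here (path-defect s _ _ _ _) u odd≡even = ⊥-elim (even≢odd u s (sym odd≡even))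

  module Colouring (def : Defect) where

    B : ℕ
    B = position def

    -- An odd vertex q avoids its left neighbour iff q < threshold, so every odd
    -- vertex keeps only the edge towards the defect.
    threshold : ℕ
    threshold = B + b2n (rightward def)

    avoided : ℕ → ℕ
    avoided q = if q <ᵇ threshold then pred q else suc q

    χ : HMap G
    χ x = if toℕ x <ᵇ P
          then (if even? (toℕ x) then true else not (straight D (vertex (avoided (toℕ x))) x))
          else not (straight D (vertex (attAt atts (toℕ x ∸ P))) x)

    χ-even : ∀ u → 2 * u < P → χ (vertex (2 * u)) ≡ true
    χ-even u 2u<P rewrite toℕ-path 2u<P | <ᵇ-true 2u<P | even?-even u = refl

    χ-odd-left : ∀ s → suc (2 * s) < P → suc (2 * s) < threshold →
                 χ (vertex (suc (2 * s))) ≡ not (straight D (vertex (2 * s)) (vertex (suc (2 * s))))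
    χ-odd-left s q<P q<thr rewrite toℕ-path q<P | <ᵇ-true q<P | even?-odd s | <ᵇ-true q<thr = refl

    χ-odd-right : ∀ s → suc (2 * s) < P → threshold ≤ suc (2 * s) →
                  χ (vertex (suc (2 * s))) ≡ not (straight D (vertex (suc (suc (2 * s)))) (vertex (suc (2 * s))))
    χ-odd-right s q<P thr≤q rewrite toℕ-path q<P | <ᵇ-true q<P | even?-odd s | <ᵇ-false {suc (2 * s)} thr≤q = refl

    χ-flag : ∀ x → P ≤ toℕ x → χ x ≡ not (straight D (vertex (attAt atts (toℕ x ∸ P))) x)
    χ-flag x P≤x rewrite <ᵇ-false {toℕ x} P≤x = refl

    avoided-unused : ∀ v x → v ≢ x → mult G v x ≡ 1 → χ x ≡ not (straight D v x) → adjℋ D (v , true) (x , χ x) ≡ false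
    avoided-unused v x v≢x single χx≡ = trans (cong (λ c → adjℋ D (v , true) (x , c)) χx≡)
                                          (trans (adjℋ-avoid D v x v≢x) (single-edge D v x v≢x single))

    odd-left-unused : ∀ s → s < m → suc (2 * s) < threshold →
      adjℋ D (vertex (2 * s) , true) (vertex (suc (2 * s)) , χ (vertex (suc (2 * s)))) ≡ false
    odd-left-unused s s<m q<thr = avoided-unused (vertex (2 * s)) (vertex (suc (2 * s)))
      (step-≢ (2 * s) q<P) (mult-step (2 * s) q<P) (χ-odd-left s q<P q<thr)
      where q<P = s≤s (*-monoʳ-< 2 s<m)

    odd-right-unused : ∀ s → s < m → threshold ≤ suc (2 * s) →
      adjℋ D (vertex (suc (suc (2 * s))) , true) (vertex (suc (2 * s)) , χ (vertex (suc (2 * s)))) ≡ false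
    odd-right-unused s s<m thr≤q = avoided-unused (vertex (suc q)) (vertex q)
      (step-≢ q 1+q<P ∘ sym) (trans (symm G (vertex (suc q)) (vertex q)) (mult-step q 1+q<P)) (χ-odd-right s q<P thr≤q)
      where
        q = suc (2 * s)
        1+q<P : suc q < P
        1+q<P = s≤s (subst (_≤ 2 * m) (*-suc 2 s) (*-monoʳ-≤ 2 s<m))
        q<P = <-trans (n<1+n q) 1+q<P

    defect-edge-unused : ∀ s → s < m → suc (2 * s) ≡ B → ∀ c →
      adjℋ D (vertex (evenEnd s (rightward def)) , true) (vertex (suc (2 * s)) , c) ≡ false
    defect-edge-unused s s<m q≡B c =
      adjℋ-unused D _ _ true c (ends-≢ (rightward def)) (proj₁ (empty-edge def s q≡B)) (proj₂ (empty-edge def s q≡B))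
      where
        q<P : suc (2 * s) < P
        q<P = s≤s (*-monoʳ-< 2 s<m)
        ends-≢ : ∀ r → vertex (evenEnd s r) ≢ vertex (suc (2 * s))
        ends-≢ true  = step-≢ (suc (2 * s)) (s≤s (subst (_≤ 2 * m) (*-suc 2 s) (*-monoʳ-≤ 2 s<m))) ∘ sym
        ends-≢ false = step-≢ (2 * s) q<P

    right-edge-used : ∀ s → s < m →
      adjℋ D (vertex (2 * s) , true) (vertex (suc (2 * s)) , χ (vertex (suc (2 * s)))) ≡ true → B < suc (2 * s)
    right-edge-used s s<m adj with suc (2 * s) <? threshold
    ... | yes q<thr = ⊥-elim (true≢false adj (odd-left-unused s s<m q<thr))
    ... | no q≮thr with B <? suc (2 * s)
    ...   | yes B<q = B<q
    ...   | no B≮q = ⊥-elim (true≢false adj (subst (λ r → adjℋ D (vertex (evenEnd s r) , true) (x , χ x) ≡ false) leftward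
                                              (defect-edge-unused s s<m q≡B (χ x))))
      where
        x = vertex (suc (2 * s))
        q≡B : suc (2 * s) ≡ B
        q≡B = ≤-antisym (≮⇒≥ B≮q) (≤-trans (m≤m+n B _) (≮⇒≥ q≮thr))
        leftward : rightward def ≡ false
        leftward = b2n≡0 (m+n≤m⇒n≡0 B (subst (threshold ≤_) q≡B (≮⇒≥ q≮thr)))

    left-edge-used : ∀ s → s < m →
      adjℋ D (vertex (suc (suc (2 * s))) , true) (vertex (suc (2 * s)) , χ (vertex (suc (2 * s)))) ≡ true → suc (2 * s) < B
    left-edge-used s s<m adj with suc (2 * s) <? threshold
    ... | no q≮thr = ⊥-elim (true≢false adj (odd-right-unused s s<m (≮⇒≥ q≮thr)))
    ... | yes q<thr with suc (2 * s) <? B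
    ...   | yes q<B = q<B
    ...   | no q≮B = ⊥-elim (true≢false adj (subst (λ r → adjℋ D (vertex (evenEnd s r) , true) (x , χ x) ≡ false) rightward≡
                                              (defect-edge-unused s s<m q≡B (χ x))))
      where
        x = vertex (suc (2 * s))
        q≤B : suc (2 * s) ≤ B
        q≤B = s≤s⁻¹ (≤-trans q<thr (≤-trans (+-monoʳ-≤ B (b2n≤1 (rightward def))) (≤-reflexive (+-comm B 1))))
        q≡B : suc (2 * s) ≡ B
        q≡B = ≤-antisym q≤B (≮⇒≥ q≮B)
        rightward≡ : rightward def ≡ true
        rightward≡ = b2n≥1 (+-cancelˡ-≤ B 1 _ (≤-trans (≤-reflexive (+-comm B 1)) (subst (λ z → suc z ≤ threshold) q≡B q<thr)))

    right-open left-open : ℕ → ℕ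
    right-open p = b2n ((suc p <ᵇ P) ∧ (B <ᵇ suc p))
    left-open  p = b2n ((0 <ᵇ p) ∧ (pred p <ᵇ B))

    right-open-≡1 : ∀ {p} → suc p < P → B < suc p → right-open p ≡ 1
    right-open-≡1 1+p<P B<1+p rewrite <ᵇ-true 1+p<P | <ᵇ-true B<1+p = refl

    left-open-≡1 : ∀ {q} → q < B → left-open (suc q) ≡ 1
    left-open-≡1 q<B rewrite <ᵇ-true q<B = refl

    right-neighbour-open : ∀ u x → toℕ x ≡ suc (2 * u) → toℕ x < P →
      adjℋ D (vertex (2 * u) , true) (x , χ x) ≡ true → right-open (2 * u) ≡ 1
    right-neighbour-open u x x≡q x<P adj = right-open-≡1 q<P
      (right-edge-used u (*-cancelˡ-< 2 u m (s<s⁻¹ q<P))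
        (subst (λ y → adjℋ D (vertex (2 * u) , true) (y , χ y) ≡ true) (vertex-of x x≡q) adj))
      where q<P = subst (_< P) x≡q x<P

    left-neighbour-open : ∀ u x → suc (toℕ x) ≡ 2 * u → u ≤ m →
      adjℋ D (vertex (2 * u) , true) (x , χ x) ≡ true → left-open (2 * u) ≡ 1
    left-neighbour-open zero    x () _ _
    left-neighbour-open (suc s) x 1+x≡2u u≤m adj = trans (cong left-open (*-suc 2 s)) (left-open-≡1
      (left-edge-used s u≤m
        (subst₂ (λ w y → adjℋ D (w , true) (y , χ y) ≡ true) (cong vertex (*-suc 2 s)) (vertex-of x x≡q) adj)))
      where
        x≡q : toℕ x ≡ suc (2 * s)
        x≡q = suc-injective (trans 1+x≡2u (*-suc 2 s))

    -- The deficient flag at p is never adjacent to v_p, so it may be added to the degree.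
    even-degree : ∀ u → u ≤ m → degφ D χ (vertex (2 * u)) + flag-defect-at def (2 * u) ≤
                                occurrences (2 * u) atts + right-open (2 * u) + left-open (2 * u)
    even-degree u u≤m = begin
      degφ D χ v + flag-defect-at def p
        ≡⟨ cong₂ _+_ (sum-map-allFin N A) (sym (∑-defect-flag def p)) ⟩
      ∑ A + ∑ (defect-flag def p)                             ≡⟨ ∑-distrib-+ A (defect-flag def p) ⟨
      ∑ (λ x → A x + defect-flag def p x)                     ≤⟨ ∑-mono-≤ pointwise ⟩
      ∑ (λ x → F x + R x + L x)                               ≡⟨ ∑-distrib-+ (λ x → F x + R x) L ⟩
      ∑ (λ x → F x + R x) + ∑ L                               ≡⟨ cong (_+ ∑ L) (∑-distrib-+ F R) ⟩
      ∑ F + ∑ R + ∑ L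
        ≡⟨ cong₂ _+_ (cong₂ _+_ (∑-flagAt p) (∑-δ (vertex (suc p)) (λ _ → right-open p)))
                     (∑-δ (vertex (pred p)) (λ _ → left-open p)) ⟩
      occurrences p atts + right-open p + left-open p         ∎
      where
        open ≤-Reasoning
        p = 2 * u
        v = vertex p
        p<P : p < P
        p<P = s≤s (*-monoʳ-≤ 2 u≤m)
        v≡p = toℕ-path p<P
        A F R L : Fin N → ℕ
        A x = b2n (adjℋ D (v , χ v) (x , χ x))
        F x = b2n (flagAt? p (toℕ x))
        R x = δ (vertex (suc p)) x (right-open p)
        L x = δ (vertex (pred p)) x (left-open p)
        rich : ∀ x → adjℋ D (v , χ v) (x , χ x) ≡ adjℋ D (v , true) (x , χ x)
        rich x = cong (λ c → adjℋ D (v , c) (x , χ x)) (χ-even u p<P)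
        neighbours : ∀ x → flagAt? p (toℕ x) ≡ false → A x ≤ R x + L x
        neighbours x not-flag with adjℋ D (v , χ v) (x , χ x) in adj
        ... | false = z≤n
        ... | true with adjacent v x (adjℋ⇒edge D χ v x adj)
        ...   | path⁺ x≡1+v x<P = ≤-trans (≤-reflexive (sym (trans (δ-vertex x _ x≡1+p)
                                    (right-neighbour-open u x x≡1+p x<P (trans (sym (rich x)) adj))))) (m≤m+n _ _)
          where x≡1+p = trans x≡1+v (cong suc v≡p)
        ...   | path⁻ v≡1+x _   = ≤-trans (≤-reflexive (sym (trans (δ-vertex x _ x≡p-1)
                                    (left-neighbour-open u x (trans (sym v≡1+x) v≡p) u≤m (trans (sym (rich x)) adj))))) (m≤n+m _ _)
          where x≡p-1 = cong pred (trans (sym v≡1+x) v≡p)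
        ...   | flag⁺ _ flag    = ⊥-elim (true≢false (flagAt?-complete (subst (λ q → FlagAt q (toℕ x)) v≡p flag)) not-flag)
        ...   | flag⁻ _ (P≤v , _) = ⊥-elim (<⇒≱ (subst (_< P) (sym v≡p) p<P) P≤v)
        pointwise : ∀ x → A x + defect-flag def p x ≤ F x + R x + L x
        pointwise x with flagAt? p (toℕ x) in flag?
        ... | false = ≤-trans (≤-reflexive (trans (cong (A x +_) (defect-flag-off def p x flag?)) (+-identityʳ (A x))))
                              (neighbours x flag?)
        ... | true  = ≤-trans (subst (λ a → a + defect-flag def p x ≤ 1) (sym (cong b2n avoid)) (defect-flag-≤ def p x))
                              (≤-trans (m≤m+n 1 (R x)) (m≤m+n _ (L x)))
          where
            flag = flagAt?-sound p (toℕ x) flag?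
            v≢x : v ≢ x
            v≢x refl = <⇒≱ (subst (_< P) (sym v≡p) p<P) (proj₁ flag)
            avoid : adjℋ D (v , χ v) (x , χ x) ≡ straight D v x ∧ cross D v x
            avoid = trans (rich x) (trans (cong (λ c → adjℋ D (v , true) (x , c)) (trans (χ-flag x (proj₁ flag))
                      (cong (λ q → not (straight D (vertex q) x)) (proj₂ flag)))) (adjℋ-avoid D v x v≢x))

    start-bound : right-open 0 + left-open 0 ≤ flag-defect-at def 0
    start-bound = ≤-trans (≤-reflexive (+-identityʳ _)) (b2n-≤ λ opened →
      ≤-reflexive (sym (flag-defect-here def 0 (n<1⇒n≡0 (<ᵇ-sound B 1 (proj₂ (∧-true {1 <ᵇ P} opened)))))))

    end-bound : right-open (2 * m) + left-open (2 * m) ≤ flag-defect-at def (2 * m)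
    end-bound rewrite <ᵇ-false {suc (2 * m)} {P} ≤-refl = b2n-≤ λ opened →
      ≤-reflexive (sym (flag-defect-here def m (≤-antisym (position≤2m def) (2m≤B (proj₂ (∧-true {0 <ᵇ 2 * m} opened))))))
      where
        2m≤B : (pred (2 * m) <ᵇ B) ≡ true → 2 * m ≤ B
        2m≤B opened = subst (_≤ B) (suc-pred (2 * m) {{>-nonZero (≤-trans 1≤m (m≤m+n m _))}}) (<ᵇ-sound _ B opened)

    interior-bound : ∀ s → right-open (2 * suc s) + left-open (2 * suc s) ≤ 1 + flag-defect-at def (2 * suc s)
    interior-bound s = b2n+b2n-≤ λ right left → ≤-reflexive (sym (flag-defect-here def (suc s)
      (≤-antisym (s≤s⁻¹ (<ᵇ-sound B _ (proj₂ (∧-true {suc (2 * suc s) <ᵇ P} right))))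
                 (subst (_≤ B) (sym (*-suc 2 s)) (<ᵇ-sound _ B (subst (λ q → (q <ᵇ B) ≡ true) (cong pred (*-suc 2 s))
                   (proj₂ (∧-true {0 <ᵇ 2 * suc s} left))))))))

    end-slack : occurrences (2 * m) atts + right-open (2 * m) + left-open (2 * m) ≤ j + flag-defect-at def (2 * m)
    end-slack = begin
      occurrences (2 * m) atts + right-open (2 * m) + left-open (2 * m)   ≡⟨ +-assoc (occurrences (2 * m) atts) _ _ ⟩
      occurrences (2 * m) atts + (right-open (2 * m) + left-open (2 * m)) ≤⟨ +-mono-≤ (≤-reflexive (flags-at-end)) end-bound ⟩
      j + flag-defect-at def (2 * m)                                      ∎
      where open ≤-Reasoning

    slack : ∀ u → u ≤ m → occurrences (2 * u) atts + right-open (2 * u) + left-open (2 * u) ≤ j + flag-defect-at def (2 * u)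
    slack zero _ = begin
      occurrences 0 atts + right-open 0 + left-open 0   ≡⟨ +-assoc (occurrences 0 atts) _ _ ⟩
      occurrences 0 atts + (right-open 0 + left-open 0) ≤⟨ +-mono-≤ (≤-reflexive (flags-at-start)) start-bound ⟩
      j + flag-defect-at def 0                          ∎
      where open ≤-Reasoning
    slack (suc s) 1+s≤m with m≤n⇒m<n∨m≡n 1+s≤m
    ... | inj₂ 1+s≡m = subst (λ u → occurrences (2 * u) atts + right-open (2 * u) + left-open (2 * u) ≤ j + flag-defect-at def (2 * u))
                             (sym 1+s≡m) end-slack
    ... | inj₁ 1+s<m = begin
      occurrences p atts + right-open p + left-open p   ≡⟨ +-assoc (occurrences p atts) _ _ ⟩
      occurrences p atts + (right-open p + left-open p) ≤⟨ +-mono-≤ (≤-reflexive (flags-interior (suc s) z<s 1+s<m)) (interior-bound s) ⟩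
      j ∸ 1 + (1 + flag-defect-at def p)                ≡⟨ +-assoc (j ∸ 1) 1 _ ⟨
      j ∸ 1 + 1 + flag-defect-at def p
        ≡⟨ cong (_+ flag-defect-at def p) (m∸n+n≡m (≤-trans (s≤s z≤n) (≤-trans 2≤i i≤j))) ⟩
      j + flag-defect-at def p                          ∎
      where
        open ≤-Reasoning
        p = 2 * suc s

    even-degφ≤j : ∀ u → u ≤ m → degφ D χ (vertex (2 * u)) ≤ j
    even-degφ≤j u u≤m = +-cancelʳ-≤ (flag-defect-at def (2 * u)) _ _ (≤-trans (even-degree u u≤m) (slack u u≤m))

    2≤bound : ∀ b → 2 ≤ (if b then j else i)
    2≤bound true  = ≤-trans 2≤i i≤j
    2≤bound false = 2≤i

    path-colouring : ∀ x a → toℕ x ≡ a → a < P → Parity a → degφ D χ x ≤ (if χ x then j else i)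
    path-colouring x _ x≡a a<P (even u) = subst (λ y → degφ D χ y ≤ (if χ y then j else i)) (sym (vertex-of x x≡a))
      (subst (λ b → degφ D χ (vertex (2 * u)) ≤ (if b then j else i)) (sym (χ-even u a<P))
        (even-degφ≤j u (*-cancelˡ-≤ 2 (s≤s⁻¹ a<P))))
    path-colouring x _ x≡a a<P (odd s) = subst (λ y → degφ D χ y ≤ (if χ y then j else i)) (sym (vertex-of x x≡a))
      (≤-trans (odd-degφ≤2 D χ s a<P) (2≤bound (χ (vertex (suc (2 * s))))))

    χ-colouring : IsColoring i j D χ
    χ-colouring x with toℕ x <? P
    ... | yes x<P = path-colouring x (toℕ x) refl x<P (parity (toℕ x))
    ... | no x≮P  = ≤-trans (flag-degφ≤1 D χ x (≮⇒≥ x≮P)) (≤-trans (n≤1+n 1) (2≤bound (χ x)))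

  deficient-colorable : ∀ x y → Deficient D x y → Colorable i j D
  deficient-colorable x y def = χ , χ-colouring
    where open Colouring (defect x y def)

proposition10p7 : (i j m : ℕ) → 1 ≤ i → i + 2 ≤ j → j ≤ 2 * i → 1 ≤ m →
                  Critical i j (Gm j m)
-- The hypothesis 1 ≤ i is implied by i + 2 ≤ j ≤ 2i.
proposition10p7 i j m _ i+2≤j j≤2i 1≤m =
  (alternating , alternating-not-colorable) ,
  proper-subgraphs-colorable i j no-isolated λ D → Repair.deficient-colorable i j m 2≤i i≤j 1≤m D
  where
    open Gₘ j m 1≤m
    open Obstruction i j m i+2≤j 1≤m
    2≤i : 2 ≤ i
    2≤i = +-cancelˡ-≤ i 2 i (≤-trans i+2≤j (≤-trans j≤2i (≤-reflexive (cong (i +_) (+-identityʳ i)))))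
    i≤j : i ≤ j
    i≤j = ≤-trans (m≤m+n i 2) i+2≤j
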